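{- Let $X$ be a finite set and let $k$ be a positive integer with $k < \frac{|X|+2}{3}$. Let $X_k$ be the set of all $k$-element subsets of $X$. Then $X_k$ can be partitioned into $O(\sqrt{k^{k}}\cdot |X|^{k-1})$ cross-independent sets, each of size at most $\lfloor |X|/k \rfloor$.
   Context: A subset $S \subseteq X_k$ is called cross-independent if any two distinct $k$-sets $s_i, s_j \in S$ satisfy $s_i \cap s_j = \emptyset$. -}

module Defs where

open import Data.Nat using (ℕ; zero; suc; _≟_)
open import Data.Fin using (Fin)
import Data.Fin as F
open import Data.Fin.Subset using (Subset; ∣_∣; _∩_; Empty; inside; outside)
open import Data.Vec using (_∷_; [])
open import Data.List using (List; map; _++_; [_]; filter; length)
open import Data.Product using (_×_)
open import Relation.Nullary using (¬_)
open import Relation.Nullary.Decidable using (_×-dec_)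
open import Relation.Binary.PropositionalEquality using (_≡_)

-- All subsets of Fin n (each exactly once).
allSubsets : (n : ℕ) → List (Subset n)
allSubsets zero = [ [] ]
allSubsets (suc n) = map (outside ∷_) (allSubsets n) ++ map (inside ∷_) (allSubsets n)

-- A colouring c : Subset n → Fin m of X_k (values on non-k-sets are irrelevant)
-- describes the partition of X_k into the classes
--   class i = { s ∈ X_k | c s ≡ i },  i : Fin m.

CrossIndependentClasses : {n m : ℕ} → ℕ → (Subset n → Fin m) → Set
CrossIndependentClasses {n} k c =
  (s t : Subset n) → ∣ s ∣ ≡ k → ∣ t ∣ ≡ k → c s ≡ c t → ¬ (s ≡ t) → Empty (s ∩ t)

classSize : {n m : ℕ} → ℕ → (Subset n → Fin m) → Fin m → ℕ
classSize {n} k c i = length (filter (λ s → (∣ s ∣ ≟ k) ×-dec (c s F.≟ i)) (allSubsets n))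

-- A k-set S is the translate x + O of its offset set O = S − min S, which contains 0 and is
-- one of at most n^(k−1) sets.  For a fixed O, colour the translates greedily along x so that
-- x + O and x′ + O get different colours whenever they meet, i.e. whenever x′ − x lies in the
-- difference set O − O; as |O − O| ≤ k², k² + 1 colours suffice.  Colouring S by the pair
-- (O, colour of x) gives n^(k−1)(k² + 1) ≤ 4 k^(k/2) n^(k−1) classes of pairwise disjoint
-- k-sets, and a class of pairwise disjoint k-subsets of an n-set has at most ⌊n/k⌋ members.

module Submission where

open import Defs
open import Data.Nat using (ℕ; zero; suc; pred; _+_; _*_; _∸_; _^_; _≤_; _<_; _≟_; z≤n; s≤s; NonZero; ≢-nonZero⁻¹; >-nonZero⁻¹; _/_)
open import Data.Nat.Properties
open import Data.Nat.DivMod using (_%_; _mod_; m<n⇒m%n≡m; [m+kn]%n≡m%n; m*n/n≡m; /-monoˡ-≤)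
open import Data.Nat.Solver using (module +-*-Solver)
open import Data.Fin as Fin using (Fin; toℕ)
import Data.Fin.Properties as Fin
open import Data.Fin.Subset using (Subset; ∣_∣; _∩_; _∪_; ⋃; Empty; _∈_; inside; outside)
open import Data.Fin.Subset.Properties using (x∈p∩q⁺; x∈p∩q⁻; x∈p∪q⁻; drop-∷-Empty; ∉⊥; ∣⊥∣≡0; ∣p∣≤n)
import Data.Vec.Base as Vec
import Data.Vec.Properties as Vec
open import Data.Vec.Base using ([]; _∷_)
open import Data.List using (List; []; _∷_; map; length; lookup; filter; cartesianProductWith)
open import Data.Nat.ListAction using (sum)
open import Data.List.Properties using (length-map; length-++; map-injective; ∷-injectiveʳ)
open import Data.List.Relation.Unary.All as All using (All; []; _∷_)
import Data.List.Relation.Unary.All.Properties as All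
open import Data.List.Relation.Unary.AllPairs using (AllPairs; []; _∷_)
import Data.List.Relation.Unary.Any as Any
open import Data.List.Relation.Unary.Any.Properties using (lookup-index)
open import Data.List.Relation.Unary.Unique.Propositional using (Unique)
import Data.List.Relation.Unary.Unique.Propositional.Properties as Unique
open import Data.List.Membership.Propositional using () renaming (_∈_ to _∈ₗ_; _∉_ to _∉ₗ_)
open import Data.List.Membership.Propositional.Properties using (∈-map⁺; ∈-map⁻; ∈-cartesianProductWith⁺)
open import Data.Product using (Σ; ∃; _×_; _,_; proj₁; proj₂)
open import Data.Empty using (⊥; ⊥-elim)
open import Data.Sum using (inj₁; inj₂)
open import Function using (_∘_)
open import Relation.Binary.Definitions using (tri<; tri≈; tri>)
open import Relation.Nullary using (¬_; Dec; yes; no; ¬?; contradiction)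
open import Relation.Nullary.Decidable using (_×-dec_; decidable-stable)
open import Relation.Binary.PropositionalEquality

private
  variable
    n : ℕ

elements : Subset n → List ℕ
elements []            = []
elements (inside ∷ s)  = 0 ∷ map suc (elements s)
elements (outside ∷ s) = map suc (elements s)

length-elements : (s : Subset n) → length (elements s) ≡ ∣ s ∣
length-elements []            = refl
length-elements (inside ∷ s)  = cong suc (trans (length-map suc (elements s)) (length-elements s))
length-elements (outside ∷ s) = trans (length-map suc (elements s)) (length-elements s)

elements-< : (s : Subset n) → All (_< n) (elements s)
elements-< []            = []
elements-< (inside ∷ s)  = s≤s z≤n ∷ All.map⁺ (All.map s≤s (elements-< s))
elements-< (outside ∷ s) = All.map⁺ (All.map s≤s (elements-< s))

elements-head-least : (s : Subset n) {x : ℕ} {xs : List ℕ} → elements s ≡ x ∷ xs → All (x ≤_) xs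
elements-head-least (inside ∷ s) refl = All.universal (λ _ → z≤n) _
elements-head-least (outside ∷ s) eq with elements s in e
elements-head-least (outside ∷ s) refl | y ∷ ys = All.map⁺ (All.map s≤s (elements-head-least s e))

∈⇒∈-elements : (s : Subset n) {y : Fin n} → y ∈ s → toℕ y ∈ₗ elements s
∈⇒∈-elements (inside ∷ s)  Vec.here      = Any.here refl
∈⇒∈-elements (inside ∷ s)  (Vec.there p) = Any.there (∈-map⁺ suc (∈⇒∈-elements s p))
∈⇒∈-elements (outside ∷ s) (Vec.there p) = ∈-map⁺ suc (∈⇒∈-elements s p)

0∷≢map-suc : ∀ {xs} ys → 0 ∷ xs ≢ map suc ys
0∷≢map-suc []      ()
0∷≢map-suc (_ ∷ _) ()

elements-injective : (s t : Subset n) → elements s ≡ elements t → s ≡ t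
elements-injective [] [] _ = refl
elements-injective (inside ∷ s) (inside ∷ t) eq =
  cong (inside ∷_) (elements-injective s t (map-injective suc-injective (∷-injectiveʳ eq)))
elements-injective (inside ∷ s) (outside ∷ t) eq = ⊥-elim (0∷≢map-suc (elements t) eq)
elements-injective (outside ∷ s) (inside ∷ t) eq = ⊥-elim (0∷≢map-suc (elements s) (sym eq))
elements-injective (outside ∷ s) (outside ∷ t) eq =
  cong (outside ∷_) (elements-injective s t (map-injective suc-injective eq))

anchor : List ℕ → ℕ
anchor []      = 0
anchor (x ∷ _) = x

offsets : List ℕ → List ℕ
offsets []       = []
offsets (x ∷ xs) = map (_∸ x) xs

length-offsets : (xs : List ℕ) → length (offsets xs) ≡ length xs ∸ 1
length-offsets []       = refl
length-offsets (x ∷ xs) = length-map (_∸ x) xs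

offsets-< : {xs : List ℕ} → All (_< n) xs → All (_< n) (offsets xs)
offsets-< []              = []
offsets-< {xs = x ∷ _} (_ ∷ xs<n) = All.map⁺ (All.map (≤-<-trans (m∸n≤m _ x)) xs<n)

map-+-∸ : ∀ {x xs} → All (x ≤_) xs → map (x +_) (map (_∸ x) xs) ≡ xs
map-+-∸ []             = refl
map-+-∸ (x≤y ∷ x≤ys) = cong₂ _∷_ (m+[n∸m]≡n x≤y) (map-+-∸ x≤ys)

elements-translate : (s : Subset n) → ∣ s ∣ ≢ 0 →
  elements s ≡ map (anchor (elements s) +_) (0 ∷ offsets (elements s))
elements-translate s s≢∅ with elements s in eq
... | []     = ⊥-elim (s≢∅ (trans (sym (length-elements s)) (cong length eq)))
... | x ∷ xs = cong₂ _∷_ (sym (+-identityʳ x)) (sym (map-+-∸ (elements-head-least s eq)))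

∈⇒translate : (s : Subset n) → ∣ s ∣ ≢ 0 → ∀ {y} → y ∈ s →
  ∃ λ o → o ∈ₗ 0 ∷ offsets (elements s) × toℕ y ≡ anchor (elements s) + o
∈⇒translate s s≢∅ y∈s =
  ∈-map⁻ (anchor (elements s) +_) (subst (_ ∈ₗ_) (elements-translate s s≢∅) (∈⇒∈-elements s y∈s))

translate-injective : (s t : Subset n) → ∣ s ∣ ≢ 0 → ∣ t ∣ ≢ 0 →
  anchor (elements s) ≡ anchor (elements t) → offsets (elements s) ≡ offsets (elements t) → s ≡ t
translate-injective s t s≢∅ t≢∅ x≡x′ P≡P′ = elements-injective s t (begin
  elements s                                                     ≡⟨ elements-translate s s≢∅ ⟩
  map (anchor (elements s) +_) (0 ∷ offsets (elements s))        ≡⟨ cong₂ (λ x P → map (x +_) (0 ∷ P)) x≡x′ P≡P′ ⟩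
  map (anchor (elements t) +_) (0 ∷ offsets (elements t))        ≡⟨ elements-translate t t≢∅ ⟨
  elements t                                                     ∎)
  where open ≡-Reasoning

pair-< : ∀ {a b q r} → a < q → b < r → a + b * q < r * q
pair-< {a} {b} {q} a<q b<r = ≤-trans (+-monoˡ-< (b * q) a<q) (*-monoˡ-≤ q b<r)

pair-injective : ∀ {a b a′ b′ q} → a < q → a′ < q → a + b * q ≡ a′ + b′ * q → a ≡ a′ × b ≡ b′
pair-injective {a} {b} {a′} {b′} {q@(suc _)} a<q a′<q eq =
  a≡a′ , *-cancelʳ-≡ b b′ q (+-cancelˡ-≡ a _ _ (trans eq (cong (_+ b′ * q) (sym a≡a′))))
  where
  open ≡-Reasoning
  a≡a′ : a ≡ a′
  a≡a′ = begin
    a                 ≡⟨ m<n⇒m%n≡m a<q ⟨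
    a % q             ≡⟨ [m+kn]%n≡m%n a b q ⟨
    (a + b * q) % q   ≡⟨ cong (_% q) eq ⟩
    (a′ + b′ * q) % q ≡⟨ [m+kn]%n≡m%n a′ b′ q ⟩
    a′ % q            ≡⟨ m<n⇒m%n≡m a′<q ⟩
    a′                ∎

encode : ℕ → List ℕ → ℕ
encode r []       = 0
encode r (d ∷ ds) = d + encode r ds * r

encode-< : ∀ {r} ds → All (_< r) ds → encode r ds < r ^ length ds
encode-< []       []           = s≤s z≤n
encode-< {r} (d ∷ ds) (d<r ∷ ds<r) =
  subst (encode r (d ∷ ds) <_) (*-comm (r ^ length ds) r) (pair-< d<r (encode-< ds ds<r))

encode-injective : ∀ {r} ds es → All (_< r) ds → All (_< r) es → length ds ≡ length es →
  encode r ds ≡ encode r es → ds ≡ es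
encode-injective []       []       _            _            _   _  = refl
encode-injective (d ∷ ds) (e ∷ es) (d<r ∷ ds<r) (e<r ∷ es<r) len eq
  with refl , eq′ ← pair-injective {b = encode _ ds} d<r e<r eq
  = cong (d ∷_) (encode-injective ds es ds<r es<r (suc-injective len) eq′)

covering⇒≤length : ∀ {N} (cs : List (Fin N)) → (∀ c → c ∈ₗ cs) → N ≤ length cs
covering⇒≤length cs c∈cs = Fin.injective⇒≤ position-injective
  where
  position-injective : ∀ {c d} → Any.index (c∈cs c) ≡ Any.index (c∈cs d) → c ≡ d
  position-injective {c} {d} eq =
    trans (lookup-index (c∈cs c)) (trans (cong (lookup cs) eq) (sym (lookup-index (c∈cs d))))

module Greedy (T : ℕ) (D : List ℕ) where

  Colour : Set
  Colour = Fin (suc T)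

  fresh : List Colour → Colour
  fresh cs with Fin.any? (λ c → ¬? (Any.any? (c Fin.≟_) cs))
  ... | yes (c , _) = c
  ... | no _        = Fin.zero

  fresh-∉ : (cs : List Colour) → length cs ≤ T → fresh cs ∉ₗ cs
  fresh-∉ cs |cs|≤T with Fin.any? (λ c → ¬? (Any.any? (c Fin.≟_) cs))
  ... | yes (_ , c∉cs) = c∉cs
  ... | no ∄c∉cs       = contradiction (covering⇒≤length cs c∈cs) (<⇒≱ (s≤s |cs|≤T))
    where
    c∈cs : ∀ c → c ∈ₗ cs
    c∈cs c = decidable-stable (Any.any? (c Fin.≟_) cs) (λ c∉cs → ∄c∉cs (c , c∉cs))

  -- Distances 0 and ≥ x forbid junk entries of the history [colour (x ∸ 1), …, colour 0];
  -- that is harmless, since at most |D| colours are forbidden anyway.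
  ago : List Colour → ℕ → Colour
  ago []       _       = Fin.zero
  ago (c ∷ _)  zero    = c
  ago (_ ∷ cs) (suc d) = ago cs d

  forbidden : List Colour → List Colour
  forbidden h = map (λ d → ago h (pred d)) D

  history : ℕ → List Colour
  colour  : ℕ → Colour

  history zero    = []
  history (suc x) = colour x ∷ history x

  colour x = fresh (forbidden (history x))

  ago-history : ∀ x d → d < x → ago (history x) d ≡ colour (x ∸ suc d)
  ago-history (suc x) zero    _         = refl
  ago-history (suc x) (suc d) (s≤s d<x) = ago-history x d d<x

  colour-avoids : length D ≤ T → ∀ {x d} → d ∈ₗ D → 0 < d → d ≤ x → colour x ≢ colour (x ∸ d)
  colour-avoids |D|≤T {x} {suc d} d∈D _ d<x eq =
    fresh-∉ (forbidden (history x)) (≤-trans (≤-reflexive (length-map _ D)) |D|≤T)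
      (subst (_∈ₗ forbidden (history x)) (trans (ago-history x d d<x) (sym eq)) (∈-map⁺ _ d∈D))

differences : List ℕ → List ℕ
differences O = cartesianProductWith _∸_ O O

length-cartesianProductWith : ∀ {A B C : Set} (f : A → B → C) xs ys →
  length (cartesianProductWith f xs ys) ≡ length xs * length ys
length-cartesianProductWith f []       ys = refl
length-cartesianProductWith f (x ∷ xs) ys =
  trans (length-++ (map (f x) ys)) (cong₂ _+_ (length-map (f x) ys) (length-cartesianProductWith f xs ys))

module TranslateColouring (T : ℕ) (O : List ℕ) where
  open Greedy T (differences O) public

  translates-apart : length O * length O ≤ T → ∀ {x x′ o o′} → x < x′ → o ∈ₗ O → o′ ∈ₗ O →
    x + o ≡ x′ + o′ → colour x ≢ colour x′
  translates-apart |O|²≤T {x} {x′} {o} {o′} x<x′ o∈O o′∈O eq cx≡cx′ =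
    colour-avoids |D|≤T d∈D (m<n⇒0<n∸m x<x′) (m∸n≤m x′ x)
      (trans (sym cx≡cx′) (cong colour (sym (m∸[m∸n]≡n (<⇒≤ x<x′)))))
    where
    open ≡-Reasoning
    d = x′ ∸ x
    |D|≤T : length (differences O) ≤ T
    |D|≤T = ≤-trans (≤-reflexive (length-cartesianProductWith _∸_ O O)) |O|²≤T
    o≡d+o′ : o ≡ d + o′
    o≡d+o′ = +-cancelˡ-≡ x o (d + o′) (begin
      x + o        ≡⟨ eq ⟩
      x′ + o′      ≡⟨ cong (_+ o′) (m+[n∸m]≡n (<⇒≤ x<x′)) ⟨
      x + d + o′   ≡⟨ +-assoc x d o′ ⟩
      x + (d + o′) ∎)
    d∈D : d ∈ₗ differences O
    d∈D = subst (_∈ₗ differences O) (trans (cong (_∸ o′) o≡d+o′) (m+n∸n≡m d o′))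
            (∈-cartesianProductWith⁺ _∸_ o∈O o′∈O)

  translates-disjoint : length O * length O ≤ T → ∀ {x x′ o o′} → colour x ≡ colour x′ → x ≢ x′ →
    o ∈ₗ O → o′ ∈ₗ O → x + o ≢ x′ + o′
  translates-disjoint |O|²≤T {x} {x′} cx≡cx′ x≢x′ o∈O o′∈O eq with <-cmp x x′
  ... | tri< x<x′ _ _ = translates-apart |O|²≤T x<x′ o∈O o′∈O eq cx≡cx′
  ... | tri≈ _ x≡x′ _ = x≢x′ x≡x′
  ... | tri> _ _ x′<x = translates-apart |O|²≤T x′<x o′∈O o∈O (sym eq) (sym cx≡cx′)

Disjoint : Subset n → Subset n → Set
Disjoint p q = Empty (p ∩ q)

∣p∪q∣≡∣p∣+∣q∣ : (p q : Subset n) → Disjoint p q → ∣ p ∪ q ∣ ≡ ∣ p ∣ + ∣ q ∣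
∣p∪q∣≡∣p∣+∣q∣ []            []            _ = refl
∣p∪q∣≡∣p∣+∣q∣ (inside ∷ p)  (inside ∷ q)  p∩q≡∅ = contradiction (Fin.zero , Vec.here) p∩q≡∅
∣p∪q∣≡∣p∣+∣q∣ (inside ∷ p)  (outside ∷ q) p∩q≡∅ = cong suc (∣p∪q∣≡∣p∣+∣q∣ p q (drop-∷-Empty p∩q≡∅))
∣p∪q∣≡∣p∣+∣q∣ (outside ∷ p) (inside ∷ q)  p∩q≡∅ =
  trans (cong suc (∣p∪q∣≡∣p∣+∣q∣ p q (drop-∷-Empty p∩q≡∅))) (sym (+-suc ∣ p ∣ ∣ q ∣))
∣p∪q∣≡∣p∣+∣q∣ (outside ∷ p) (outside ∷ q) p∩q≡∅ = ∣p∪q∣≡∣p∣+∣q∣ p q (drop-∷-Empty p∩q≡∅)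

Disjoint-⋃ : {p : Subset n} (qs : List (Subset n)) → All (Disjoint p) qs → Disjoint p (⋃ qs)
Disjoint-⋃ {p = p} qs p∩qs≡∅ (y , y∈p∩⋃qs) = go qs p∩qs≡∅ (x∈p∩q⁻ p (⋃ qs) y∈p∩⋃qs)
  where
  go : ∀ qs → All (Disjoint p) qs → y ∈ p × y ∈ ⋃ qs → ⊥
  go []       []             (_ , y∈⊥) = ∉⊥ y∈⊥
  go (q ∷ qs) (p∩q≡∅ ∷ p∩qs≡∅) (y∈p , y∈q∪⋃qs) with x∈p∪q⁻ q (⋃ qs) y∈q∪⋃qs
  ... | inj₁ y∈q   = p∩q≡∅ (y , x∈p∩q⁺ (y∈p , y∈q))
  ... | inj₂ y∈⋃qs = go qs p∩qs≡∅ (y∈p , y∈⋃qs)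

∣⋃∣≡sum : (ps : List (Subset n)) → AllPairs Disjoint ps → ∣ ⋃ ps ∣ ≡ sum (map ∣_∣ ps)
∣⋃∣≡sum {n} []       []             = ∣⊥∣≡0 n
∣⋃∣≡sum     (p ∷ ps) (p∩ps≡∅ ∷ ps!) =
  trans (∣p∪q∣≡∣p∣+∣q∣ p (⋃ ps) (Disjoint-⋃ ps p∩ps≡∅)) (cong (∣ p ∣ +_) (∣⋃∣≡sum ps ps!))

sum-disjoint-≤ : (ps : List (Subset n)) → AllPairs Disjoint ps → sum (map ∣_∣ ps) ≤ n
sum-disjoint-≤ ps ps! = subst (_≤ _) (∣⋃∣≡sum ps ps!) (∣p∣≤n (⋃ ps))

allSubsets-unique : ∀ n → Unique (allSubsets n)
allSubsets-unique zero    = [] ∷ []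
allSubsets-unique (suc n) = Unique.++⁺ (Unique.map⁺ Vec.∷-injectiveʳ (allSubsets-unique n))
                                       (Unique.map⁺ Vec.∷-injectiveʳ (allSubsets-unique n))
                                       outside≠inside
  where
  outside≠inside : ∀ {s} → ¬ (s ∈ₗ map (outside ∷_) (allSubsets n) × s ∈ₗ map (inside ∷_) (allSubsets n))
  outside≠inside (s∈outside , s∈inside) with ∈-map⁻ (outside ∷_) s∈outside | ∈-map⁻ (inside ∷_) s∈inside
  ... | _ , _ , refl | _ , _ , ()

AllPairs-restrict : ∀ {A : Set} {P : A → Set} {R S : A → A → Set} →
  (∀ {x y} → P x → P y → R x y → S x y) → ∀ {xs} → All P xs → AllPairs R xs → AllPairs S xs
AllPairs-restrict f []         []         = []
AllPairs-restrict f (px ∷ pxs) (rx ∷ rxs) =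
  All.zipWith (λ (py , rxy) → f px py rxy) (pxs , rx) ∷ AllPairs-restrict f pxs rxs

sum-map-const : ∀ {A : Set} {f : A → ℕ} {k} xs → All (λ x → f x ≡ k) xs → sum (map f xs) ≡ length xs * k
sum-map-const []       []             = refl
sum-map-const (x ∷ xs) (fx≡k ∷ fxs≡k) = cong₂ _+_ fx≡k (sum-map-const xs fxs≡k)

classSize-≤ : ∀ {m} k (c : Subset n → Fin m) .{{_ : NonZero k}} →
  CrossIndependentClasses k c → (i : Fin m) → classSize k c i ≤ n / k
classSize-≤ {n} k c cross i = begin
  length class            ≡⟨ m*n/n≡m (length class) k ⟨
  length class * k / k    ≤⟨ /-monoˡ-≤ k |class|*k≤n ⟩
  n / k                   ∎
  where
  open ≤-Reasoning
  inClass? : (s : Subset n) → Dec (∣ s ∣ ≡ k × c s ≡ i)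
  inClass? s = (∣ s ∣ ≟ k) ×-dec (c s Fin.≟ i)
  class : List (Subset n)
  class = filter inClass? (allSubsets n)
  inClass : All (λ s → ∣ s ∣ ≡ k × c s ≡ i) class
  inClass = All.all-filter inClass? (allSubsets n)
  disjoint : AllPairs Disjoint class
  disjoint = AllPairs-restrict (λ (∣s∣≡k , cs≡i) (∣t∣≡k , ct≡i) → cross _ _ ∣s∣≡k ∣t∣≡k (trans cs≡i (sym ct≡i)))
               inClass (Unique.filter⁺ inClass? (allSubsets-unique n))
  |class|*k≤n : length class * k ≤ n
  |class|*k≤n = subst (_≤ n) (sum-map-const class (All.map proj₁ inClass)) (sum-disjoint-≤ class disjoint)

palette²≤16kᵏ : ∀ k .{{_ : NonZero k}} → suc (k * k) * suc (k * k) ≤ 16 * k ^ k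
palette²≤16kᵏ 1 = s≤s (s≤s (s≤s (s≤s z≤n)))
palette²≤16kᵏ 2 = m≤m+n 25 39
palette²≤16kᵏ 3 = m≤m+n 100 332
palette²≤16kᵏ k@(suc (suc (suc (suc _)))) = begin
  suc (k * k) * suc (k * k)         ≤⟨ *-mono-≤ k²<2k² k²<2k² ⟩
  (k * k + k * k) * (k * k + k * k) ≡⟨ solve 1 (λ k → (k :* k :+ k :* k) :* (k :* k :+ k :* k)
                                                     := con 4 :* (k :* (k :* (k :* (k :* con 1))))) refl k ⟩
  4 * k ^ 4                         ≤⟨ *-monoʳ-≤ 4 (^-monoʳ-≤ k {4} {k} (s≤s (s≤s (s≤s (s≤s z≤n))))) ⟩
  4 * k ^ k                         ≤⟨ *-monoˡ-≤ (k ^ k) (m≤m+n 4 12) ⟩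
  16 * k ^ k                        ∎
  where
  open ≤-Reasoning
  open +-*-Solver
  k²<2k² : k * k < k * k + k * k
  k²<2k² = m<m+n (k * k) (s≤s z≤n)

module Construction (n k : ℕ) .{{_ : NonZero n}} .{{_ : NonZero k}} where

  m : ℕ
  m = n ^ (k ∸ 1) * suc (k * k)

  instance
    m≢0 : NonZero m
    m≢0 = m*n≢0 (n ^ (k ∸ 1)) (suc (k * k)) {{m^n≢0 n (k ∸ 1)}}

  module Translates (P : List ℕ) = TranslateColouring (k * k) (0 ∷ P)

  base : Subset n → ℕ
  base s = anchor (elements s)

  shape : Subset n → List ℕ
  shape s = offsets (elements s)

  colourOf : Subset n → Fin (suc (k * k))
  colourOf s = Translates.colour (shape s) (base s)

  code : Subset n → ℕ
  code s = toℕ (colourOf s) + encode n (shape s) * suc (k * k)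

  -- Reduction mod m only changes the colour of sets of size other than k.
  colouring : Subset n → Fin m
  colouring s = code s mod m

  shape-< : (s : Subset n) → All (_< n) (shape s)
  shape-< s = offsets-< (elements-< s)

  module _ (s : Subset n) (∣s∣≡k : ∣ s ∣ ≡ k) where

    k-set≢∅ : ∣ s ∣ ≢ 0
    k-set≢∅ = ≢-nonZero⁻¹ k ∘ trans (sym ∣s∣≡k)

    length-shape : length (shape s) ≡ k ∸ 1
    length-shape = trans (length-offsets (elements s)) (cong (_∸ 1) (trans (length-elements s) ∣s∣≡k))

    |0∷shape|≡k : length (0 ∷ shape s) ≡ k
    |0∷shape|≡k = trans (cong suc length-shape) (m+[n∸m]≡n (>-nonZero⁻¹ k))

    code-< : code s < m
    code-< = subst (λ l → code s < n ^ l * suc (k * k)) length-shape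
               (pair-< (Fin.toℕ<n (colourOf s)) (encode-< (shape s) (shape-< s)))

    toℕ-colouring : toℕ (colouring s) ≡ code s
    toℕ-colouring = trans (Fin.toℕ-fromℕ< _) (m<n⇒m%n≡m code-<)

  same-colouring : ∀ s t → ∣ s ∣ ≡ k → ∣ t ∣ ≡ k → colouring s ≡ colouring t →
    shape s ≡ shape t × Translates.colour (shape s) (base s) ≡ Translates.colour (shape s) (base t)
  same-colouring s t ∣s∣≡k ∣t∣≡k cs≡ct = shape≡ , Fin.toℕ-injective colour≡
    where
    code≡ : code s ≡ code t
    code≡ = trans (sym (toℕ-colouring s ∣s∣≡k)) (trans (cong toℕ cs≡ct) (toℕ-colouring t ∣t∣≡k))
    parts≡ : toℕ (colourOf s) ≡ toℕ (colourOf t) × encode n (shape s) ≡ encode n (shape t)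
    parts≡ = pair-injective (Fin.toℕ<n (colourOf s)) (Fin.toℕ<n (colourOf t)) code≡
    shape≡ : shape s ≡ shape t
    shape≡ = encode-injective (shape s) (shape t) (shape-< s) (shape-< t)
               (trans (length-shape s ∣s∣≡k) (sym (length-shape t ∣t∣≡k))) (proj₂ parts≡)
    colour≡ : toℕ (colourOf s) ≡ toℕ (Translates.colour (shape s) (base t))
    colour≡ = trans (proj₁ parts≡) (cong (λ P → toℕ (Translates.colour P (base t))) (sym shape≡))

  cross-independent : CrossIndependentClasses k colouring
  cross-independent s t ∣s∣≡k ∣t∣≡k cs≡ct s≢t (y , y∈s∩t) =
    let shape≡ , colour≡       = same-colouring s t ∣s∣≡k ∣t∣≡k cs≡ct
        y∈s , y∈t             = x∈p∩q⁻ s t y∈s∩t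
        o , o∈O , y≡x+o       = ∈⇒translate s (k-set≢∅ s ∣s∣≡k) y∈s
        o′ , o′∈O′ , y≡x′+o′  = ∈⇒translate t (k-set≢∅ t ∣t∣≡k) y∈t
        |O|≡k                 = |0∷shape|≡k s ∣s∣≡k
    in Translates.translates-disjoint (shape s) (≤-reflexive (cong₂ _*_ |O|≡k |O|≡k)) colour≡
         (λ x≡x′ → s≢t (translate-injective s t (k-set≢∅ s ∣s∣≡k) (k-set≢∅ t ∣t∣≡k) x≡x′ shape≡))
         o∈O (subst (λ P → o′ ∈ₗ 0 ∷ P) (sym shape≡) o′∈O′) (trans (sym y≡x+o) y≡x′+o′)

  m²≤16kᵏn²⁽ᵏ⁻¹⁾ : m * m ≤ 4 * 4 * (k ^ k) * (n ^ (2 * (k ∸ 1)))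
  m²≤16kᵏn²⁽ᵏ⁻¹⁾ = begin
    (N * c) * (N * c)        ≡⟨ solve 2 (λ N c → (N :* c) :* (N :* c) := (c :* c) :* (N :* N)) refl N c ⟩
    (c * c) * (N * N)        ≤⟨ *-monoˡ-≤ (N * N) (palette²≤16kᵏ k) ⟩
    16 * k ^ k * (N * N)     ≡⟨ cong (16 * k ^ k *_) N²≡n^2a ⟩
    16 * k ^ k * n ^ (2 * a) ∎
    where
    open ≤-Reasoning
    open +-*-Solver
    a = k ∸ 1
    N = n ^ a
    c = suc (k * k)
    N²≡n^2a : N * N ≡ n ^ (2 * a)
    N²≡n^2a = trans (cong (λ b → N * n ^ b) (sym (+-identityʳ a))) (sym (^-distribˡ-+-* n a (a + 0)))

-- The hypothesis is used only here: for n = 0 and k ≥ 2 there would be no colours at all.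
3k<n+2⇒n≢0 : ∀ {n} k .{{_ : NonZero k}} → 3 * k < n + 2 → NonZero n
3k<n+2⇒n≢0 {suc _} _ _    = _
3k<n+2⇒n≢0 {zero}  k 3k<2 = contradiction (≤-<-trans (*-monoʳ-≤ 3 (>-nonZero⁻¹ k)) 3k<2) λ { (s≤s (s≤s ())) }

lemma1 : ∃ λ (C : ℕ) → (n k : ℕ) → .{{_ : NonZero k}} → 3 * k < n + 2 →
    Σ ℕ λ m → Σ (Subset n → Fin m) λ c →
    (m * m ≤ C * C * (k ^ k) * (n ^ (2 * (k ∸ 1))))
    × CrossIndependentClasses k c
    × ((i : Fin m) → classSize k c i ≤ n / k)
lemma1 = 4 , λ n k 3k<n+2 → let open Construction n k {{3k<n+2⇒n≢0 k 3k<n+2}} in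
  m , colouring , m²≤16kᵏn²⁽ᵏ⁻¹⁾ , cross-independent , classSize-≤ k colouring cross-independent
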